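{- Let $G=(V,E)$ be a finite, simple, connected graph with $|V|\ge 2$ such that $\mathrm{QEC}(G)<-1/2$. Then the clique graph $\Gamma(G)$ is a tree. Moreover, any two maximal cliques $H_1,H_2$ of $G$ that are adjacent in $\Gamma(G)$ satisfy $|H_1\cap H_2|=1$, and any three mutually distinct maximal cliques $H_1,H_2,H_3$ of $G$ satisfy $H_1\cap H_2\cap H_3=\emptyset$.
   Context: For a finite connected graph $G=(V,E)$ with $|V|\ge2$, let $D=[d_G(x,y)]_{x,y\in V}$ be its distance matrix ($d_G$ the graph distance). The quadratic embedding constant is $\mathrm{QEC}(G)=\max\{\langle f,Df\rangle : f\in\mathbb{R}^V,\ \langle f,f\rangle=1,\ \langle \mathbf{1},f\rangle=0\}$, where $\mathbf{1}$ is the all-ones vector and $\langle\cdot,\cdot\rangle$ the standard inner product. A clique is a nonempty vertex subset inducing a complete graph; a maximal clique is one maximal under inclusion. The clique graph $\Gamma(G)$ has as vertices the maximal cliques of $G$, with two maximal cliques $H_1,H_2$ adjacent iff $H_1\neq H_2$ and $H_1\cap H_2\neq\emptyset$. -}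

module Defs where

open import Data.Nat using (ℕ; zero; suc; _≤_)
open import Data.Bool using (Bool; true; false; _∨_; _∧_; if_then_else_)
open import Data.Fin using (Fin; zero; suc; _≟_)
open import Data.Fin.Subset using (Subset; _∈_; _⊆_; _∩_; Nonempty; Empty; ∣_∣)
open import Data.Rational using (ℚ; 0ℚ; _+_; _*_; _<_; -½; _/_)
open import Data.Integer using (+_)
open import Data.List using (List; []; _∷_; _++_; [_]; length)
open import Data.List.Relation.Unary.All using (All)
open import Data.List.Relation.Unary.Unique.Propositional using (Unique)
open import Data.List.Relation.Unary.Linked using (Linked)
open import Data.Product using (Σ; ∃; _×_)
open import Relation.Nullary using (¬_)
open import Relation.Nullary.Decidable using (⌊_⌋)
open import Relation.Binary.PropositionalEquality using (_≡_; _≢_)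

record Graph (n : ℕ) : Set where
  field
    adj    : Fin n → Fin n → Bool
    sym    : ∀ x y → adj x y ≡ adj y x
    irrefl : ∀ x → adj x x ≡ false
open Graph public

data Walk {n : ℕ} (G : Graph n) : Fin n → Fin n → ℕ → Set where
  here : ∀ {x} → Walk G x x 0
  step : ∀ {x y z k} → adj G x y ≡ true → Walk G y z k → Walk G x z (suc k)

Connected : ∀ {n} → Graph n → Set
Connected G = ∀ x y → ∃ λ k → Walk G x y k

anyFin : ∀ {n} → (Fin n → Bool) → Bool
anyFin {zero}  p = false
anyFin {suc n} p = p zero ∨ anyFin (λ i → p (suc i))

reachWithin : ∀ {n} → Graph n → ℕ → Fin n → Fin n → Bool
reachWithin G zero    x y = ⌊ x ≟ y ⌋
reachWithin G (suc k) x y =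
  reachWithin G k x y ∨ anyFin (λ z → adj G x z ∧ reachWithin G k z y)

-- graph distance: least k with reachWithin G k x y (search up to n;
-- for a connected graph the value found is the true distance)
distSearch : ∀ {n} → Graph n → Fin n → Fin n → ℕ → ℕ → ℕ
distSearch G x y zero    k = k
distSearch G x y (suc m) k =
  if reachWithin G k x y then k else distSearch G x y m (suc k)

dist : ∀ {n} → Graph n → Fin n → Fin n → ℕ
dist {n} G x y = distSearch G x y n 0

Σℚ : ∀ {n} → (Fin n → ℚ) → ℚ
Σℚ {zero}  f = 0ℚ
Σℚ {suc n} f = f zero + Σℚ (λ i → f (suc i))

quadD : ∀ {n} → Graph n → (Fin n → ℚ) → ℚ
quadD G f = Σℚ (λ x → Σℚ (λ y → f x * ((+ dist G x y / 1) * f y)))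

normSq : ∀ {n} → (Fin n → ℚ) → ℚ
normSq f = Σℚ (λ x → f x * f x)

-- QEC(G) < -1/2, stated homogeneously over rational vectors:
-- for every nonzero f with ⟨1,f⟩ = 0,  ⟨f,Df⟩ < -1/2 ⟨f,f⟩.
QEC<-½ : ∀ {n} → Graph n → Set
QEC<-½ G = ∀ (f : _ → ℚ) → Σℚ f ≡ 0ℚ → (∃ λ i → f i ≢ 0ℚ) →
           quadD G f < -½ * normSq f

IsClique : ∀ {n} → Graph n → Subset n → Set
IsClique G S = Nonempty S ×
  (∀ x y → x ∈ S → y ∈ S → x ≢ y → adj G x y ≡ true)

IsMaximalClique : ∀ {n} → Graph n → Subset n → Set
IsMaximalClique G S = IsClique G S × (∀ T → IsClique G T → S ⊆ T → T ≡ S)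

ΓAdj : ∀ {n} → Subset n → Subset n → Set
ΓAdj H₁ H₂ = H₁ ≢ H₂ × Nonempty (H₁ ∩ H₂)

data Chain {A : Set} (P : A → Set) (R : A → A → Set) : A → A → Set where
  stop : ∀ {x} → P x → Chain P R x x
  cons : ∀ {x y z} → P x → R x y → Chain P R y z → Chain P R x z

IsCycle : {A : Set} → (A → Set) → (A → A → Set) → A → List A → Set
IsCycle P R x ys = 2 ≤ length ys × Unique (x ∷ ys) × All P (x ∷ ys) ×
                   Linked R (x ∷ ys ++ [ x ])

IsTree : {A : Set} → (A → Set) → (A → A → Set) → Set
IsTree {A} P R = (∃ λ x → P x) ×
                 (∀ x y → P x → P y → Chain P R x y) ×
                 (∀ x ys → ¬ IsCycle P R x ys)

CliqueGraphIsTree : ∀ {n} → Graph n → Set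
CliqueGraphIsTree G = IsTree (IsMaximalClique G) ΓAdj

{-# OPTIONS --safe #-}
-- Testing QEC(G) < -1/2 on the integer vectors δ₁ - δ₂ + δ₃ - δ₄ and -3δₒ + δₐ + δ_b + δ_c gives a
-- strict four-point inequality d₁₃ + d₂₄ + 1 < d₁₂ + d₂₃ + d₃₄ + d₄₁ for distinct vertices and
-- excludes induced claws; in particular every 4-cycle has both chords.  From these local facts two
-- distinct maximal cliques share at most one vertex, no vertex lies in three maximal cliques, and a
-- vertex v shared by maximal cliques H ≠ H′ separates H from H′: a shortest path from H to H′
-- avoiding v closes up through v to a cycle that is isometric in G, and on such a cycle of length
-- at least 5 four suitably spaced vertices violate the four-point inequality (shorter cycles are
-- excluded by the chord property).  A cycle of maximal cliques in Γ(G) would provide such a path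
-- around a shared vertex, so Γ(G), which is connected because G is, is a tree.
module Submission where

open import Defs hiding (sym)
open import Data.Nat as ℕ hiding (_≟_)
open import Data.Nat.Properties hiding (_≟_)
open import Data.Nat.Induction using (<-rec; <-wellFounded)
import Data.Nat.GCD as ℕGCD
import Data.Nat.Tactic.RingSolver as ℕ-Solver
open import Data.Integer as ℤ using (ℤ; +_; 0ℤ; 1ℤ)
import Data.Integer.Properties as ℤP
import Data.Integer.GCD as ℤGCD
import Data.Integer.Tactic.RingSolver as ℤ-Solver
open import Data.Rational as ℚ using (ℚ; ↥_; ↧_; ↧ₙ_; 0ℚ; -½)
import Data.Rational.Properties as ℚP
open import Data.Bool as Bool using (Bool; true; false; _∧_)
open import Data.Bool.Properties using (∨-zeroʳ)
open import Data.Fin as Fin using (Fin; zero; suc; _≟_; toℕ)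
import Data.Fin.Properties as Fin
open import Data.Fin.Subset using (Subset; _∈_; _∉_; _⊆_; _∩_; _∪_; ⁅_⁆; Empty; ∣_∣)
open import Data.Fin.Subset.Properties
  using (_∈?_; _⊆?_; x∈p∩q⁺; x∈p∩q⁻; p⊆p∪q; q⊆p∪q; x∈p∪q⁻; x∈⁅x⁆; x∈⁅y⁆⇒x≡y; ⊆-antisym; ∣⁅x⁆∣≡1;
         p⊂q⇒∣p∣<∣q∣; ∣p∣≤n)
open import Data.Vec.Properties using (≡-dec)
open import Data.List as List using (List; []; _∷_; [_])
open import Data.List.Relation.Unary.All as All using (All; []; _∷_)
open import Data.List.Relation.Unary.AllPairs using ([]; _∷_)
open import Data.List.Relation.Unary.Linked using (Linked; [-]; _∷_)
open import Data.List.Relation.Unary.Unique.Propositional using (Unique)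
open import Data.Product using (Σ; ∃; _×_; _,_; proj₁; proj₂)
open import Data.Sum using (_⊎_; inj₁; inj₂)
open import Data.Empty using (⊥; ⊥-elim)
open import Function using (_∘_; id)
open import Induction.WellFounded using (Acc; acc)
open import Relation.Binary.PropositionalEquality hiding ([_])
open import Relation.Nullary using (¬_; Dec; yes; no)
open import Relation.Nullary.Decidable using (_×-dec_; _→-dec_; ¬?)
import Algebra.Properties.Semiring.Sum ℤP.+-*-semiring as ℤΣ
open ℤΣ using (sum)

private variable n : ℕ

⌈n/2⌉≤1+⌊n/2⌋ : ∀ n → ⌈ n /2⌉ ≤ suc ⌊ n /2⌋
⌈n/2⌉≤1+⌊n/2⌋ zero          = z≤n
⌈n/2⌉≤1+⌊n/2⌋ (suc zero)    = s≤s z≤n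
⌈n/2⌉≤1+⌊n/2⌋ (suc (suc n)) = s≤s (⌈n/2⌉≤1+⌊n/2⌋ n)

-- The QEC bound on integer vectors

toℚ : ℤ → ℚ
toℚ a = a ℚ./ 1

private
  gcd-1 : ∀ a → ℤGCD.gcd a 1ℤ ≡ 1ℤ
  gcd-1 a = cong +_ (ℕGCD.gcd-zeroʳ ℤ.∣ a ∣)

↥-toℚ : ∀ a → ↥ toℚ a ≡ a
↥-toℚ a = begin
  ↥ toℚ a                     ≡⟨ ℤP.*-identityʳ _ ⟨
  ↥ toℚ a ℤ.* 1ℤ              ≡⟨ cong (↥ toℚ a ℤ.*_) (gcd-1 a) ⟨
  ↥ toℚ a ℤ.* ℤGCD.gcd a 1ℤ  ≡⟨ ℚP.↥-/ a 1 ⟩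
  a                           ∎
  where open ≡-Reasoning

↧-toℚ : ∀ a → ↧ toℚ a ≡ 1ℤ
↧-toℚ a = begin
  ↧ toℚ a                     ≡⟨ ℤP.*-identityʳ _ ⟨
  ↧ toℚ a ℤ.* 1ℤ              ≡⟨ cong (↧ toℚ a ℤ.*_) (gcd-1 a) ⟨
  ↧ toℚ a ℤ.* ℤGCD.gcd a 1ℤ  ≡⟨ ℚP.↧-/ a 1 ⟩
  1ℤ                          ∎
  where open ≡-Reasoning

↧ₙ-toℚ : ∀ a → ↧ₙ toℚ a ≡ 1
↧ₙ-toℚ a = cong ℤ.∣_∣ (↧-toℚ a)

↥*↧-toℚ : ∀ a b → ↥ toℚ a ℤ.* ↧ toℚ b ≡ a
↥*↧-toℚ a b = trans (cong₂ ℤ._*_ (↥-toℚ a) (↧-toℚ b)) (ℤP.*-identityʳ a)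

toℚ-+ : ∀ a b → toℚ a ℚ.+ toℚ b ≡ toℚ (a ℤ.+ b)
toℚ-+ a b = trans (+-unfold (toℚ a) (toℚ b)) (ℚP./-cong numerators denominators)
  where
  +-unfold : ∀ p q → p ℚ.+ q ≡ (↥ p ℤ.* ↧ q ℤ.+ ↥ q ℤ.* ↧ p) ℚ./ (↧ₙ p ℕ.* ↧ₙ q)
  +-unfold (ℚ.mkℚ _ _ _) (ℚ.mkℚ _ _ _) = refl
  numerators : ↥ toℚ a ℤ.* ↧ toℚ b ℤ.+ ↥ toℚ b ℤ.* ↧ toℚ a ≡ a ℤ.+ b
  numerators = cong₂ ℤ._+_ (↥*↧-toℚ a b) (↥*↧-toℚ b a)
  denominators : ↧ₙ toℚ a ℕ.* ↧ₙ toℚ b ≡ 1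
  denominators = cong₂ ℕ._*_ (↧ₙ-toℚ a) (↧ₙ-toℚ b)

toℚ-* : ∀ a b → toℚ a ℚ.* toℚ b ≡ toℚ (a ℤ.* b)
toℚ-* a b = trans (*-unfold (toℚ a) (toℚ b))
  (ℚP./-cong (cong₂ ℤ._*_ (↥-toℚ a) (↥-toℚ b)) (cong₂ ℕ._*_ (↧ₙ-toℚ a) (↧ₙ-toℚ b)))
  where
  *-unfold : ∀ p q → p ℚ.* q ≡ (↥ p ℤ.* ↥ q) ℚ./ (↧ₙ p ℕ.* ↧ₙ q)
  *-unfold (ℚ.mkℚ _ _ _) (ℚ.mkℚ _ _ _) = refl

toℚ-cancel-< : ∀ {a b} → toℚ a ℚ.< toℚ b → a ℤ.< b
toℚ-cancel-< {a} {b} a<b = subst₂ ℤ._<_ (↥*↧-toℚ a b) (↥*↧-toℚ b a) (ℚP.drop-*<* a<b)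

toℚ≡0⇒≡0 : ∀ {a} → toℚ a ≡ 0ℚ → a ≡ 0ℤ
toℚ≡0⇒≡0 {a} eq = trans (sym (↥-toℚ a)) (cong ↥_ eq)

toℚ-sum : (F : Fin n → ℤ) → toℚ (sum F) ≡ Σℚ (toℚ ∘ F)
toℚ-sum {zero}  F = refl
toℚ-sum {suc n} F = trans (sym (toℚ-+ (F zero) _)) (cong (toℚ (F zero) ℚ.+_) (toℚ-sum (F ∘ suc)))

Σℚ-cong : {f g : Fin n → ℚ} → (∀ i → f i ≡ g i) → Σℚ f ≡ Σℚ g
Σℚ-cong {zero}  f≗g = refl
Σℚ-cong {suc n} f≗g = cong₂ ℚ._+_ (f≗g zero) (Σℚ-cong (f≗g ∘ suc))

quadℤ : Graph n → (Fin n → ℤ) → ℤ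
quadℤ G F = sum (λ x → sum (λ y → F x ℤ.* (+ dist G x y ℤ.* F y)))

normℤ : (Fin n → ℤ) → ℤ
normℤ F = sum (λ x → F x ℤ.* F x)

toℚ-quad : (G : Graph n) (F : Fin n → ℤ) → toℚ (quadℤ G F) ≡ quadD G (toℚ ∘ F)
toℚ-quad {n} G F = trans (toℚ-sum {n} _) (Σℚ-cong λ x → trans (toℚ-sum {n} _) (Σℚ-cong λ y →
  trans (sym (toℚ-* (F x) _)) (cong (toℚ (F x) ℚ.*_) (sym (toℚ-* (+ dist G x y) (F y))))))

toℚ-norm : (F : Fin n → ℤ) → toℚ (normℤ F) ≡ normSq (toℚ ∘ F)
toℚ-norm {n} F = trans (toℚ-sum {n} _) (Σℚ-cong λ x → sym (toℚ-* (F x) (F x)))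

qec-ℤ : (G : Graph n) → QEC<-½ G → (F : Fin n → ℤ) → sum F ≡ 0ℤ → ∀ i → F i ≢ 0ℤ →
        ∀ M → normℤ F ≡ + 2 ℤ.* M → quadℤ G F ℤ.< ℤ.- M
qec-ℤ G qec F ΣF≡0 i Fi≢0 M ‖F‖≡2M = toℚ-cancel-< (subst₂ ℚ._<_ (sym (toℚ-quad G F)) bound
  (qec (toℚ ∘ F) (trans (sym (toℚ-sum F)) (cong toℚ ΣF≡0)) (i , Fi≢0 ∘ toℚ≡0⇒≡0)))
  where
  open ≡-Reasoning
  bound : -½ ℚ.* normSq (toℚ ∘ F) ≡ toℚ (ℤ.- M)
  bound = begin
    -½ ℚ.* normSq (toℚ ∘ F)          ≡⟨ cong (-½ ℚ.*_) (sym (toℚ-norm F)) ⟩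
    -½ ℚ.* toℚ (normℤ F)              ≡⟨ cong (λ z → -½ ℚ.* toℚ z) ‖F‖≡2M ⟩
    -½ ℚ.* toℚ (+ 2 ℤ.* M)            ≡⟨ cong (-½ ℚ.*_) (sym (toℚ-* (+ 2) M)) ⟩
    -½ ℚ.* (toℚ (+ 2) ℚ.* toℚ M)      ≡⟨ sym (ℚP.*-assoc -½ (toℚ (+ 2)) (toℚ M)) ⟩
    -½ ℚ.* toℚ (+ 2) ℚ.* toℚ M        ≡⟨⟩
    toℚ (ℤ.- 1ℤ) ℚ.* toℚ M            ≡⟨ toℚ-* (ℤ.- 1ℤ) M ⟩
    toℚ (ℤ.- 1ℤ ℤ.* M)                ≡⟨ cong toℚ (ℤP.-1*i≡-i M) ⟩
    toℚ (ℤ.- M)                       ∎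

δ : Fin n → Fin n → ℤ
δ zero    zero    = 1ℤ
δ zero    (suc _) = 0ℤ
δ (suc _) zero    = 0ℤ
δ (suc x) (suc y) = δ x y

δ-refl : (x : Fin n) → δ x x ≡ 1ℤ
δ-refl zero    = refl
δ-refl (suc x) = δ-refl x

δ-≢ : {x y : Fin n} → x ≢ y → δ x y ≡ 0ℤ
δ-≢ {x = zero}  {zero}  x≢y = ⊥-elim (x≢y refl)
δ-≢ {x = zero}  {suc y} x≢y = refl
δ-≢ {x = suc x} {zero}  x≢y = refl
δ-≢ {x = suc x} {suc y} x≢y = δ-≢ (x≢y ∘ cong suc)

sum-δ* : (p : Fin n) (g : Fin n → ℤ) → sum (λ x → δ x p ℤ.* g x) ≡ g p
sum-δ* {suc n} zero g =
  trans (cong₂ ℤ._+_ (ℤP.*-identityˡ (g zero)) (ℤΣ.sum-replicate-zero n)) (ℤP.+-identityʳ (g zero))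
sum-δ* {suc n} (suc p) g = trans (ℤP.+-identityˡ _) (sum-δ* p (g ∘ suc))

Weights : ℕ → Set
Weights n = List (ℤ × Fin n)

points : Weights n → List (Fin n)
points = List.map proj₂

infix 8 _·_
_·_ : Weights n → (Fin n → ℤ) → ℤ
[]             · g = 0ℤ
((c , p) ∷ ws) · g = c ℤ.* g p ℤ.+ ws · g

combination : Weights n → Fin n → ℤ
combination ws x = ws · δ x

form : Weights n → (Fin n → Fin n → ℤ) → ℤ
form ws K = ws · (λ x → ws · K x)

squares : Weights n → ℤ
squares []             = 0ℤ
squares ((c , _) ∷ ws) = c ℤ.* c ℤ.+ squares ws

·-cong : (ws : Weights n) {g h : Fin n → ℤ} → All (λ x → g x ≡ h x) (points ws) → ws · g ≡ ws · h
·-cong []             []           = refl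
·-cong ((c , p) ∷ ws) (gp≡hp ∷ eqs) = cong₂ (λ a b → c ℤ.* a ℤ.+ b) gp≡hp (·-cong ws eqs)

sum-combination* : (ws : Weights n) (g : Fin n → ℤ) → sum (λ x → combination ws x ℤ.* g x) ≡ ws · g
sum-combination* {n} []             g = trans (ℤΣ.sum-cong-≗ (ℤP.*-zeroˡ ∘ g)) (ℤΣ.sum-replicate-zero n)
sum-combination* {n} ((c , p) ∷ ws) g = begin
  sum (λ x → (c ℤ.* δ x p ℤ.+ combination ws x) ℤ.* g x)
    ≡⟨ ℤΣ.sum-cong-≗ (λ x → distrib c (δ x p) (combination ws x) (g x)) ⟩
  sum (λ x → c ℤ.* (δ x p ℤ.* g x) ℤ.+ combination ws x ℤ.* g x)
    ≡⟨ ℤΣ.∑-distrib-+ (λ x → c ℤ.* (δ x p ℤ.* g x)) _ ⟩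
  sum (λ x → c ℤ.* (δ x p ℤ.* g x)) ℤ.+ sum (λ x → combination ws x ℤ.* g x)
    ≡⟨ cong₂ ℤ._+_ (sym (ℤΣ.*-distribˡ-sum {n} c _)) (sum-combination* ws g) ⟩
  c ℤ.* sum (λ x → δ x p ℤ.* g x) ℤ.+ ws · g
    ≡⟨ cong (λ s → c ℤ.* s ℤ.+ ws · g) (sum-δ* p g) ⟩
  c ℤ.* g p ℤ.+ ws · g ∎
  where
  open ≡-Reasoning
  distrib : ∀ c d e g → (c ℤ.* d ℤ.+ e) ℤ.* g ≡ c ℤ.* (d ℤ.* g) ℤ.+ e ℤ.* g
  distrib = ℤ-Solver.solve-∀

sum-combination : (ws : Weights n) → sum (combination ws) ≡ ws · (λ _ → 1ℤ)
sum-combination {n} ws =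
  trans (ℤΣ.sum-cong-≗ (sym ∘ ℤP.*-identityʳ ∘ combination ws)) (sum-combination* ws (λ _ → 1ℤ))

norm-combination : (ws : Weights n) → normℤ (combination ws) ≡ ws · combination ws
norm-combination ws = sum-combination* ws (combination ws)

quad-combination : (G : Graph n) (ws : Weights n) →
                   quadℤ G (combination ws) ≡ form ws (λ x y → + dist G x y)
quad-combination {n} G ws = begin
  sum (λ x → sum (λ y → combination ws x ℤ.* (+ dist G x y ℤ.* combination ws y)))
    ≡⟨ ℤΣ.sum-cong-≗ (λ x →
         trans (ℤΣ.sum-cong-≗ {n} (λ y → cong (combination ws x ℤ.*_) (ℤP.*-comm (+ dist G x y) _)))
               (sym (ℤΣ.*-distribˡ-sum {n} (combination ws x) _))) ⟩
  sum (λ x → combination ws x ℤ.* sum (λ y → combination ws y ℤ.* + dist G x y))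
    ≡⟨ ℤΣ.sum-cong-≗ (λ x → cong (combination ws x ℤ.*_) (sum-combination* ws _)) ⟩
  sum (λ x → combination ws x ℤ.* (ws · (λ y → + dist G x y)))
    ≡⟨ sum-combination* ws _ ⟩
  form ws (λ x y → + dist G x y) ∎
  where open ≡-Reasoning

combination-∉ : (ws : Weights n) {x : Fin n} → All (x ≢_) (points ws) → combination ws x ≡ 0ℤ
combination-∉ []             []             = refl
combination-∉ ((c , p) ∷ ws) (x≢p ∷ x∉ws) =
  trans (cong₂ (λ a b → c ℤ.* a ℤ.+ b) (δ-≢ x≢p) (combination-∉ ws x∉ws)) (cong (ℤ._+ 0ℤ) (ℤP.*-zeroʳ c))

combination-head : ∀ c p (ws : Weights n) → All (p ≢_) (points ws) → combination ((c , p) ∷ ws) p ≡ c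
combination-head c p ws p∉ws = begin
  c ℤ.* δ p p ℤ.+ combination ws p ≡⟨ cong₂ (λ a b → c ℤ.* a ℤ.+ b) (δ-refl p) (combination-∉ ws p∉ws) ⟩
  c ℤ.* 1ℤ ℤ.+ 0ℤ                    ≡⟨ trans (ℤP.+-identityʳ _) (ℤP.*-identityʳ c) ⟩
  c                                  ∎
  where open ≡-Reasoning

combination-squares : (ws : Weights n) → Unique (points ws) → ws · combination ws ≡ squares ws
combination-squares []             []                  = refl
combination-squares ((c , p) ∷ ws) (p∉ws ∷ unique-ws) = cong₂ ℤ._+_
  (cong (c ℤ.*_) (combination-head c p ws p∉ws))
  (trans (·-cong ws (All.map drop-p (All.map ≢-sym p∉ws))) (combination-squares ws unique-ws))
  where
  drop-p : ∀ {x} → x ≢ p → c ℤ.* δ x p ℤ.+ combination ws x ≡ combination ws x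
  drop-p {x} x≢p = begin
    c ℤ.* δ x p ℤ.+ combination ws x ≡⟨ cong (λ a → c ℤ.* a ℤ.+ combination ws x) (δ-≢ x≢p) ⟩
    c ℤ.* 0ℤ ℤ.+ combination ws x     ≡⟨ cong (ℤ._+ combination ws x) (ℤP.*-zeroʳ c) ⟩
    0ℤ ℤ.+ combination ws x           ≡⟨ ℤP.+-identityˡ _ ⟩
    combination ws x                  ∎
    where open ≡-Reasoning

qec-form : (G : Graph n) → QEC<-½ G → ∀ c p (ws : Weights n) → Unique (points ((c , p) ∷ ws)) → c ≢ 0ℤ →
           ((c , p) ∷ ws) · (λ _ → 1ℤ) ≡ 0ℤ → ∀ M → squares ((c , p) ∷ ws) ≡ + 2 ℤ.* M →
           form ((c , p) ∷ ws) (λ x y → + dist G x y) ℤ.< ℤ.- M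
qec-form G qec c p ws unique@(p∉ws ∷ _) c≢0 balanced M squares≡2M =
  subst (ℤ._< ℤ.- M) (quad-combination G vs)
    (qec-ℤ G qec (combination vs) (trans (sum-combination vs) balanced) p
      (c≢0 ∘ trans (sym (combination-head c p ws p∉ws)))
      M (trans (norm-combination vs) (trans (combination-squares vs unique) squares≡2M)))
  where vs = (c , p) ∷ ws

+m-+n<-+k⇒m+k<n : ∀ m n k → + m ℤ.- + n ℤ.< ℤ.- + k → m ℕ.+ k ℕ.< n
+m-+n<-+k⇒m+k<n m n k m-n<-k = ℤP.drop‿+<+ (subst₂ ℤ._<_ (shift (+ m) (+ n) (+ k)) (cancel (+ n) (+ k))
                                   (ℤP.+-monoˡ-< (+ n ℤ.+ + k) m-n<-k))
  where
  shift : ∀ m n k → m ℤ.- n ℤ.+ (n ℤ.+ k) ≡ m ℤ.+ k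
  shift = ℤ-Solver.solve-∀
  cancel : ∀ n k → ℤ.- k ℤ.+ (n ℤ.+ k) ≡ n
  cancel = ℤ-Solver.solve-∀

-- The left-hand sides are what form unfolds to for the weights (1,p₁),(-1,p₂),(1,p₃),(-1,p₄)
-- and (-3,o),(1,a),(1,b),(1,c), with aᵢⱼ the kernel at (pᵢ,pⱼ).
cycle-expansion : ∀ (a₁₁ a₁₂ a₁₃ a₁₄ a₂₁ a₂₂ a₂₃ a₂₄ a₃₁ a₃₂ a₃₃ a₃₄ a₄₁ a₄₂ a₄₃ a₄₄ : ℤ) →
  let row : ℤ → ℤ → ℤ → ℤ → ℤ
      row x₁ x₂ x₃ x₄ = 1ℤ ℤ.* x₁ ℤ.+ (ℤ.- 1ℤ ℤ.* x₂ ℤ.+ (1ℤ ℤ.* x₃ ℤ.+ (ℤ.- 1ℤ ℤ.* x₄ ℤ.+ 0ℤ)))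
  in row (row a₁₁ a₁₂ a₁₃ a₁₄) (row a₂₁ a₂₂ a₂₃ a₂₄) (row a₃₁ a₃₂ a₃₃ a₃₄) (row a₄₁ a₄₂ a₄₃ a₄₄)
     ≡ (a₁₁ ℤ.+ a₂₂ ℤ.+ a₃₃ ℤ.+ a₄₄)
       ℤ.+ ((a₁₃ ℤ.+ a₃₁) ℤ.+ (a₂₄ ℤ.+ a₄₂)
            ℤ.- ((a₁₂ ℤ.+ a₂₁) ℤ.+ (a₂₃ ℤ.+ a₃₂) ℤ.+ (a₃₄ ℤ.+ a₄₃) ℤ.+ (a₄₁ ℤ.+ a₁₄)))
cycle-expansion = ℤ-Solver.solve-∀

claw-expansion : ∀ (a₀₀ a₀₁ a₀₂ a₀₃ a₁₀ a₁₁ a₁₂ a₁₃ a₂₀ a₂₁ a₂₂ a₂₃ a₃₀ a₃₁ a₃₂ a₃₃ : ℤ) →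
  let row : ℤ → ℤ → ℤ → ℤ → ℤ
      row x₀ x₁ x₂ x₃ = ℤ.- + 3 ℤ.* x₀ ℤ.+ (1ℤ ℤ.* x₁ ℤ.+ (1ℤ ℤ.* x₂ ℤ.+ (1ℤ ℤ.* x₃ ℤ.+ 0ℤ)))
  in row (row a₀₀ a₀₁ a₀₂ a₀₃) (row a₁₀ a₁₁ a₁₂ a₁₃) (row a₂₀ a₂₁ a₂₂ a₂₃) (row a₃₀ a₃₁ a₃₂ a₃₃)
     ≡ (+ 9 ℤ.* a₀₀ ℤ.+ a₁₁ ℤ.+ a₂₂ ℤ.+ a₃₃)
       ℤ.+ ((a₁₂ ℤ.+ a₂₁) ℤ.+ (a₁₃ ℤ.+ a₃₁) ℤ.+ (a₂₃ ℤ.+ a₃₂)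
            ℤ.- + 3 ℤ.* ((a₀₁ ℤ.+ a₁₀) ℤ.+ (a₀₂ ℤ.+ a₂₀) ℤ.+ (a₀₃ ℤ.+ a₃₀)))
claw-expansion = ℤ-Solver.solve-∀

-- Paths and distances

module Paths {n : ℕ} (G : Graph n) where

  private variable
    x y z v : Fin n

  adj-sym : adj G x y ≡ true → adj G y x ≡ true
  adj-sym {x} {y} e = trans (Graph.sym G y x) e

  neighbour≢non-neighbour : adj G x y ≡ true → adj G x z ≡ false → y ≢ z
  neighbour≢non-neighbour x~y x≁z refl with trans (sym x~y) x≁z
  ... | ()

  adj⇒≢ : adj G x y ≡ true → x ≢ y
  adj⇒≢ {x} x~y refl = neighbour≢non-neighbour x~y (irrefl G x) refl

  Nonisolated : Set
  Nonisolated = ∀ x → ∃ λ z → adj G x z ≡ true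

  nonisolated : 2 ≤ n → Connected G → Nonisolated
  nonisolated (s≤s (s≤s _)) connected x = first-step (proj₂ (connected x (other x))) (other-≢ x)
    where
    other : ∀ {m} → Fin (suc (suc m)) → Fin (suc (suc m))
    other zero    = suc zero
    other (suc _) = zero
    other-≢ : ∀ {m} (x : Fin (suc (suc m))) → x ≢ other x
    other-≢ zero    ()
    other-≢ (suc _) ()
    first-step : ∀ {x y k} → Walk G x y k → x ≢ y → ∃ λ z → adj G x z ≡ true
    first-step here         x≢x = ⊥-elim (x≢x refl)
    first-step (step x~z _) _   = _ , x~z

  infixr 5 _∷_ _++_

  data Path : Fin n → Fin n → Set where
    []  : ∀ {x} → Path x x
    _∷_ : ∀ {x y z} → adj G x y ≡ true → Path y z → Path x z

  length : Path x y → ℕ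
  length []      = 0
  length (_ ∷ p) = suc (length p)

  _++_ : Path x y → Path y z → Path x z
  []      ++ q = q
  (e ∷ p) ++ q = e ∷ (p ++ q)

  length-++ : (p : Path x y) (q : Path y z) → length (p ++ q) ≡ length p + length q
  length-++ []      q = refl
  length-++ (e ∷ p) q = cong suc (length-++ p q)

  length-++₃ : ∀ {w} (p : Path x y) (q : Path y z) (r : Path z w) →
               length (p ++ q ++ r) ≡ length p + (length q + length r)
  length-++₃ p q r = trans (length-++ p (q ++ r)) (cong (_+_ (length p)) (length-++ q r))

  reverse : Path x y → Path y x
  reverse []      = []
  reverse (e ∷ p) = reverse p ++ adj-sym e ∷ []

  length-reverse : (p : Path x y) → length (reverse p) ≡ length p
  length-reverse []      = refl
  length-reverse (e ∷ p) = trans (length-++ (reverse p) _) (trans (+-comm _ 1) (cong suc (length-reverse p)))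

  vertexAt : Path x y → ℕ → Fin n
  vertexAt {x} []      _       = x
  vertexAt {x} (_ ∷ _) zero    = x
  vertexAt     (_ ∷ p) (suc k) = vertexAt p k

  take : (p : Path x y) (k : ℕ) → Path x (vertexAt p k)
  take []      _       = []
  take (_ ∷ _) zero    = []
  take (e ∷ p) (suc k) = e ∷ take p k

  drop : (p : Path x y) (k : ℕ) → Path (vertexAt p k) y
  drop []      _       = []
  drop (e ∷ p) zero    = e ∷ p
  drop (_ ∷ p) (suc k) = drop p k

  vertexAt-step : (p : Path x y) {k : ℕ} → k < length p → adj G (vertexAt p k) (vertexAt p (suc k)) ≡ true
  vertexAt-step (e ∷ [])    {zero}  _         = e
  vertexAt-step (e ∷ _ ∷ _) {zero}  _         = e
  vertexAt-step (_ ∷ p)     {suc k} (s≤s k<l) = vertexAt-step p k<l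

  length-take : (p : Path x y) {k : ℕ} → k ≤ length p → length (take p k) ≡ k
  length-take []      z≤n       = refl
  length-take (_ ∷ _) z≤n       = refl
  length-take (_ ∷ p) (s≤s k≤l) = cong suc (length-take p k≤l)

  length-take-≤ : (p : Path x y) (k : ℕ) → length (take p k) ≤ k
  length-take-≤ []      _       = z≤n
  length-take-≤ (_ ∷ _) zero    = z≤n
  length-take-≤ (_ ∷ p) (suc k) = s≤s (length-take-≤ p k)

  length-drop : (p : Path x y) (k : ℕ) → length (drop p k) ≡ length p ∸ k
  length-drop []      k       = sym (0∸n≡0 k)
  length-drop (_ ∷ _) zero    = refl
  length-drop (_ ∷ p) (suc k) = length-drop p k

  Avoids : Fin n → Path x y → Set
  Avoids v ([] {x})     = x ≢ v
  Avoids v (_∷_ {x} _ p) = x ≢ v × Avoids v p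

  avoids-head : (p : Path x y) → Avoids v p → x ≢ v
  avoids-head []      x≢v       = x≢v
  avoids-head (_ ∷ _) (x≢v , _) = x≢v

  avoids-last : (p : Path x y) → Avoids v p → y ≢ v
  avoids-last []      y≢v       = y≢v
  avoids-last (_ ∷ p) (_ , av)  = avoids-last p av

  avoids-++ : (p : Path x y) (q : Path y z) → Avoids v p → Avoids v q → Avoids v (p ++ q)
  avoids-++ []      q _            av-q = av-q
  avoids-++ (_ ∷ p) q (x≢v , av-p) av-q = x≢v , avoids-++ p q av-p av-q

  avoids-reverse : (p : Path x y) → Avoids v p → Avoids v (reverse p)
  avoids-reverse []      x≢v          = x≢v
  avoids-reverse (_ ∷ p) (x≢v , av-p) = avoids-++ (reverse p) _ (avoids-reverse p av-p) (avoids-head p av-p , x≢v)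

  avoids-take : (p : Path x y) (k : ℕ) → Avoids v p → Avoids v (take p k)
  avoids-take []      _       x≢v          = x≢v
  avoids-take (_ ∷ _) zero    (x≢v , _)    = x≢v
  avoids-take (_ ∷ p) (suc k) (x≢v , av-p) = x≢v , avoids-take p k av-p

  avoids-drop : (p : Path x y) (k : ℕ) → Avoids v p → Avoids v (drop p k)
  avoids-drop []      _       av       = av
  avoids-drop (_ ∷ _) zero    av       = av
  avoids-drop (_ ∷ p) (suc k) (_ , av) = avoids-drop p k av

  shortcut : (p : Path x y) {i j : ℕ} → i < j → j ≤ length p → vertexAt p i ≡ vertexAt p j →
             Σ (Path x y) λ q → length q < length p
  shortcut {y = y} p {i} {j} i<j j≤l loop = take p i ++ rest , (begin-strict
    length (take p i ++ rest)       ≡⟨ length-++ (take p i) rest ⟩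
    length (take p i) + length rest ≡⟨ cong (_+_ (length (take p i))) (length-subst (sym loop) (drop p j)) ⟩
    length (take p i) + length (drop p j) ≤⟨ +-monoˡ-≤ _ (length-take-≤ p i) ⟩
    i + length (drop p j)           <⟨ +-monoˡ-< _ i<j ⟩
    j + length (drop p j)           ≡⟨ cong (_+_ j) (length-drop p j) ⟩
    j + (length p ∸ j)              ≡⟨ m+[n∸m]≡n j≤l ⟩
    length p                        ∎)
    where
    open ≤-Reasoning
    rest = subst (λ w → Path w y) (sym loop) (drop p j)
    length-subst : ∀ {w w′} (eq : w ≡ w′) (q : Path w y) → length (subst (λ w → Path w y) eq q) ≡ length q
    length-subst refl q = refl

  shorten : (p : Path x y) → Σ (Path x y) λ q → length q < n
  shorten p = go p (<-wellFounded (length p))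
    where
    go : (p : Path x y) → Acc _<_ (length p) → Σ (Path x y) λ q → length q < n
    go p (acc shorter) with length p <? n
    ... | yes l<n = p , l<n
    ... | no  l≮n with Fin.pigeonhole (n<1+n n) (vertexAt p ∘ toℕ)
    ...   | i , j , i<j , loop with shortcut p i<j (≤-trans (Fin.toℕ≤pred[n] j) (≮⇒≥ l≮n)) loop
    ...     | q , q<p = go q (shorter q<p)

  private
    anyFin-intro : ∀ {m} (f : Fin m → Bool) (i : Fin m) → f i ≡ true → anyFin f ≡ true
    anyFin-intro f zero    fi≡true rewrite fi≡true = refl
    anyFin-intro f (suc i) fi≡true rewrite anyFin-intro (f ∘ suc) i fi≡true = ∨-zeroʳ (f zero)

    anyFin-elim : ∀ {m} (f : Fin m → Bool) → anyFin f ≡ true → ∃ λ i → f i ≡ true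
    anyFin-elim {suc m} f any with f zero in f0
    ... | true  = zero , f0
    ... | false with anyFin-elim (f ∘ suc) any
    ...   | i , fi = suc i , fi

    path⇒reachWithin : (p : Path x y) → reachWithin G (length p) x y ≡ true
    path⇒reachWithin {x} [] with x ≟ x
    ... | yes _   = refl
    ... | no  x≢x = ⊥-elim (x≢x refl)
    path⇒reachWithin {x} {y} (_∷_ {y = z} e p) with reachWithin G (length p) x y
    ... | true  = refl
    ... | false = anyFin-intro _ z (cong₂ _∧_ e (path⇒reachWithin p))

    reachWithin⇒path : ∀ k → reachWithin G k x y ≡ true → Σ (Path x y) λ p → length p ≤ k
    reachWithin⇒path {x} {y} zero r with x ≟ y
    ... | yes refl = [] , z≤n
    reachWithin⇒path {x} {y} (suc k) r with reachWithin G k x y in r′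
    ... | true with reachWithin⇒path k r′
    ...   | p , p≤k = p , m≤n⇒m≤1+n p≤k
    reachWithin⇒path {x} {y} (suc k) r | false with anyFin-elim _ r
    ... | z , z-step with adj G x z in e | reachWithin G k z y in r″
    ...   | true | true with reachWithin⇒path k r″
    ...     | p , p≤k = e ∷ p , s≤s p≤k

    distSearch-≤ : ∀ m j k → j ≤ k → reachWithin G k x y ≡ true → distSearch G x y m j ≤ k
    distSearch-≤ zero j k j≤k _ = j≤k
    distSearch-≤ {x} {y} (suc m) j k j≤k r with reachWithin G j x y in rj
    ... | true  = j≤k
    ... | false with m≤n⇒m<n∨m≡n j≤k
    ...   | inj₁ j<k  = distSearch-≤ m (suc j) k j<k r
    ...   | inj₂ refl with trans (sym rj) r
    ...     | ()

    distSearch-≥-start : ∀ m j → j ≤ distSearch G x y m j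
    distSearch-≥-start zero    j = ≤-refl
    distSearch-≥-start {x} {y} (suc m) j with reachWithin G j x y
    ... | true  = ≤-refl
    ... | false = ≤-trans (n≤1+n j) (distSearch-≥-start m (suc j))

    distSearch-≥ : ∀ t m j → (∀ i → j ≤ i → i < t → reachWithin G i x y ≡ false) → t ≤ j + m →
                   t ≤ distSearch G x y m j
    distSearch-≥ t zero j unreachable t≤j+0 = subst (t ≤_) (+-identityʳ j) t≤j+0
    distSearch-≥ {x} {y} t (suc m) j unreachable t≤j+m with <-≤-connex j t
    ... | inj₂ t≤j = ≤-trans t≤j (distSearch-≥-start (suc m) j)
    ... | inj₁ j<t with reachWithin G j x y in rj
    ...   | true with trans (sym rj) (unreachable j ≤-refl j<t)
    ...     | ()
    distSearch-≥ {x} {y} t (suc m) j unreachable t≤j+m | inj₁ j<t | false =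
      distSearch-≥ t m (suc j) (λ i j<i → unreachable i (<⇒≤ j<i)) (subst (t ≤_) (+-suc j m) t≤j+m)

    dist-≥-bounded : ∀ t → t ≤ n → (∀ (p : Path x y) → t ≤ length p) → t ≤ dist G x y
    dist-≥-bounded {x} {y} t t≤n long = distSearch-≥ t n 0 unreachable t≤n
      where
      unreachable : ∀ i → 0 ≤ i → i < t → reachWithin G i x y ≡ false
      unreachable i _ i<t with reachWithin G i x y in r
      ... | false = refl
      ... | true with reachWithin⇒path i r
      ...   | p , p≤i = ⊥-elim (<-irrefl refl (≤-trans (s≤s p≤i) (≤-trans i<t (long p))))

  dist-≤-length : (p : Path x y) → dist G x y ≤ length p
  dist-≤-length p = distSearch-≤ n 0 (length p) z≤n (path⇒reachWithin p)

  -- dist only searches walks of length at most n, so a lower bound on all path lengths reaches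
  -- it through a path shorter than n.
  dist-≥ : Path x y → ∀ t → (∀ (q : Path x y) → t ≤ length q) → t ≤ dist G x y
  dist-≥ p t long with shorten p
  ... | q , q<n = dist-≥-bounded t (≤-trans (long q) (<⇒≤ q<n)) long

  positive-length⇒≢ : (∀ (p : Path x y) → 1 ≤ length p) → x ≢ y
  positive-length⇒≢ long refl with long []
  ... | ()

  dist-refl : ∀ x → dist G x x ≡ 0
  dist-refl x = n≤0⇒n≡0 (dist-≤-length [])

  -- dist is not symmetric by definition, so bounds are stated for the round trip.
  d⇄ : Fin n → Fin n → ℕ
  d⇄ x y = dist G x y + dist G y x

  d⇄-≤ : (p : Path x y) → d⇄ x y ≤ length p + length p
  d⇄-≤ p = +-mono-≤ (dist-≤-length p) (subst (_ ≤_) (length-reverse p) (dist-≤-length (reverse p)))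

  d⇄-≥ : Path x y → ∀ t → (∀ (q : Path x y) → t ≤ length q) → t + t ≤ d⇄ x y
  d⇄-≥ p t long = +-mono-≤ (dist-≥ p t long)
    (dist-≥ (reverse p) t (λ q → subst (t ≤_) (length-reverse q) (long (reverse q))))

  d⇄-adj : adj G x y ≡ true → d⇄ x y ≤ 2
  d⇄-adj x~y = d⇄-≤ (x~y ∷ [])

  d⇄-≢ : Path x y → x ≢ y → 2 ≤ d⇄ x y
  d⇄-≢ p x≢y = d⇄-≥ p 1 nonempty
    where
    nonempty : ∀ q → 1 ≤ length q
    nonempty []      = ⊥-elim (x≢y refl)
    nonempty (_ ∷ _) = s≤s z≤n

  d⇄-nonadj : Path x y → x ≢ y → adj G x y ≡ false → 4 ≤ d⇄ x y
  d⇄-nonadj p x≢y x≁y = d⇄-≥ p 2 long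
    where
    long : ∀ q → 2 ≤ length q
    long []          = ⊥-elim (x≢y refl)
    long (x~y ∷ [])  = ⊥-elim (neighbour≢non-neighbour x~y x≁y refl)
    long (_ ∷ _ ∷ _) = s≤s (s≤s z≤n)

  record Detour (v x y : Fin n) (ℓ : ℕ) : Set where
    constructor detour
    field
      {u u′}        : Fin n
      to-v          : Path x u
      from-v        : Path u′ y
      to-v-avoids   : Avoids v to-v
      from-v-avoids : Avoids v from-v
      u~v           : adj G u v ≡ true
      v~u′          : adj G v u′ ≡ true
      shorter       : length to-v + length from-v + 2 ≤ ℓ

  private
    first-visit : (p : Path x y) → x ≢ v → Avoids v p ⊎
      ∃ λ u → Σ (Path x u) λ q → Avoids v q × adj G u v ≡ true ×
        Σ (Path v y) λ r → length p ≡ length q + suc (length r)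
    first-visit []                  x≢v = inj₁ x≢v
    first-visit {v = v} (_∷_ {x} {z} e p) x≢v with z ≟ v
    ... | yes refl = inj₂ (x , [] , x≢v , e , p , refl)
    ... | no  z≢v with first-visit p z≢v
    ...   | inj₁ av = inj₁ (x≢v , av)
    ...   | inj₂ (u , q , av-q , u~v , r , len) = inj₂ (u , e ∷ q , (x≢v , av-q) , u~v , r , cong suc len)

    last-visit : (p : Path x y) → y ≢ v → Avoids v p ⊎
      ∃ λ u′ → Σ (Path u′ y) λ q → Avoids v q × adj G v u′ ≡ true × length q < length p
    last-visit []                  y≢v = inj₁ y≢v
    last-visit {v = v} (_∷_ {x} {z} e p) y≢v with last-visit p y≢v
    ... | inj₂ (u′ , q , av-q , v~u′ , q<p) = inj₂ (u′ , q , av-q , v~u′ , m<n⇒m<1+n q<p)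
    ... | inj₁ av with x ≟ v
    ...   | yes refl = inj₂ (z , p , av , e , n<1+n (length p))
    ...   | no  x≢v  = inj₁ (x≢v , av)

  avoids-or-detour : (p : Path x y) → x ≢ v → y ≢ v → Avoids v p ⊎ Detour v x y (length p)
  avoids-or-detour p x≢v y≢v with first-visit p x≢v
  ... | inj₁ av = inj₁ av
  ... | inj₂ (u , q , av-q , u~v , r , len) with last-visit r y≢v
  ...   | inj₁ av-r = ⊥-elim (avoids-head r av-r refl)
  ...   | inj₂ (u′ , q′ , av-q′ , v~u′ , q′<r) = inj₂ (detour q q′ av-q av-q′ u~v v~u′ (begin
    length q + length q′ + 2     ≡⟨ +-assoc (length q) _ 2 ⟩
    length q + (length q′ + 2)   ≡⟨ cong (_+_ (length q)) (+-comm _ 2) ⟩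
    length q + suc (suc (length q′)) ≤⟨ +-monoʳ-≤ (length q) (s≤s q′<r) ⟩
    length q + suc (length r)    ≡⟨ sym len ⟩
    length p                     ∎))
    where open ≤-Reasoning

-- Cliques and the clique graph

module Cliques {n : ℕ} (G : Graph n) where
  open Paths G

  private variable
    x y u : Fin n
    S H H′ : Subset n

  clique-adj : IsClique G S → x ∈ S → y ∈ S → x ≢ y → adj G x y ≡ true
  clique-adj (_ , adjacent) = adjacent _ _

  maximal-adj : IsMaximalClique G H → x ∈ H → y ∈ H → x ≢ y → adj G x y ≡ true
  maximal-adj = clique-adj ∘ proj₁

  Joinable : Subset n → Fin n → Set
  Joinable S u = ∀ s → s ∈ S → s ≢ u → adj G u s ≡ true

  joinable? : ∀ S u → Dec (Joinable S u)
  joinable? S u = Fin.all? λ s → s ∈? S →-dec (¬? (s ≟ u) →-dec (adj G u s Bool.≟ true))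

  clique-∪-⁅⁆ : IsClique G S → Joinable S u → IsClique G (S ∪ ⁅ u ⁆)
  clique-∪-⁅⁆ {S} {u} ((s , s∈S) , S-clique) u~S = (s , p⊆p∪q ⁅ u ⁆ s∈S) , adjacent
    where
    adjacent : ∀ x y → x ∈ S ∪ ⁅ u ⁆ → y ∈ S ∪ ⁅ u ⁆ → x ≢ y → adj G x y ≡ true
    adjacent x y x∈ y∈ x≢y with x∈p∪q⁻ S ⁅ u ⁆ x∈ | x∈p∪q⁻ S ⁅ u ⁆ y∈
    ... | inj₁ x∈S | inj₁ y∈S = S-clique x y x∈S y∈S x≢y
    ... | inj₁ x∈S | inj₂ y∈u rewrite x∈⁅y⁆⇒x≡y u y∈u = adj-sym (u~S x x∈S x≢y)
    ... | inj₂ x∈u | inj₁ y∈S rewrite x∈⁅y⁆⇒x≡y u x∈u = u~S y y∈S (≢-sym x≢y)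
    ... | inj₂ x∈u | inj₂ y∈u = ⊥-elim (x≢y (trans (x∈⁅y⁆⇒x≡y u x∈u) (sym (x∈⁅y⁆⇒x≡y u y∈u))))

  maximal-absorbs : IsMaximalClique G H → Joinable H u → u ∈ H
  maximal-absorbs {H} {u} (H-clique , maximal) u~H =
    subst (u ∈_) (maximal _ (clique-∪-⁅⁆ H-clique u~H) (p⊆p∪q ⁅ u ⁆)) (q⊆p∪q H ⁅ u ⁆ (x∈⁅x⁆ u))

  outside-maximal : IsMaximalClique G H → u ∉ H → ∃ λ h → h ∈ H × h ≢ u × adj G u h ≡ false
  outside-maximal {H} {u} H-max u∉H with joinable? H u
  ... | yes u~H = ⊥-elim (u∉H (maximal-absorbs H-max u~H))
  ... | no  u≁H with Fin.¬∀⟶∃¬ n _ (λ s → s ∈? H →-dec (¬? (s ≟ u) →-dec (adj G u s Bool.≟ true))) u≁H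
  ...   | h , ¬h~u with h ∈? H | h ≟ u | adj G u h in u~h
  ...     | yes h∈H | no h≢u | false = h , h∈H , h≢u , u~h
  ...     | yes h∈H | no h≢u | true  = ⊥-elim (¬h~u (λ _ _ → refl))
  ...     | yes h∈H | yes h≡u | _    = ⊥-elim (¬h~u (λ _ h≢u → ⊥-elim (h≢u h≡u)))
  ...     | no  h∉H | _       | _    = ⊥-elim (¬h~u (λ h∈H → ⊥-elim (h∉H h∈H)))

  maximal-⊈ : IsMaximalClique G H → IsClique G H′ → H ≢ H′ → ∃ λ a → a ∈ H × a ∉ H′
  maximal-⊈ {H} {H′} (_ , maximal) H′-clique H≢H′ with H ⊆? H′
  ... | yes H⊆H′ = ⊥-elim (H≢H′ (sym (maximal H′ H′-clique H⊆H′)))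
  ... | no  H⊈H′ with Fin.¬∀⟶∃¬ n (λ a → a ∈ H → a ∈ H′) (λ a → a ∈? H →-dec a ∈? H′) (λ ⊆ → H⊈H′ (⊆ _))
  ...   | a , a∉ with a ∈? H
  ...     | yes a∈H = a , a∈H , a∉ ∘ λ a∈H′ _ → a∈H′
  ...     | no  a∉H = ⊥-elim (a∉ (⊥-elim ∘ a∉H))

  extend-to-maximal : IsClique G S → ∃ λ T → IsMaximalClique G T × S ⊆ T
  extend-to-maximal {S} S-clique = grow n S-clique (m≤n+m n _)
    where
    grow : ∀ k {S} → IsClique G S → n ≤ ∣ S ∣ + k → ∃ λ T → IsMaximalClique G T × S ⊆ T
    grow k {S} S-clique n≤∣S∣+k with Fin.any? (λ u → ¬? (u ∈? S) ×-dec joinable? S u)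
    ... | no none = S , (S-clique , maximal) , id
      where
      maximal : ∀ T → IsClique G T → S ⊆ T → T ≡ S
      maximal T T-clique S⊆T = ⊆-antisym T⊆S S⊆T
        where
        T⊆S : T ⊆ S
        T⊆S {x} x∈T with x ∈? S
        ... | yes x∈S = x∈S
        ... | no  x∉S = ⊥-elim (none (x , x∉S , λ s s∈S s≢x → clique-adj T-clique x∈T (S⊆T s∈S) (≢-sym s≢x)))
    ... | yes (u , u∉S , u~S) = grow′ k n≤∣S∣+k
      where
      grows : ∣ S ∣ < ∣ S ∪ ⁅ u ⁆ ∣
      grows = p⊂q⇒∣p∣<∣q∣ (p⊆p∪q ⁅ u ⁆ , u , q⊆p∪q S ⁅ u ⁆ (x∈⁅x⁆ u) , u∉S)
      grow′ : ∀ k → n ≤ ∣ S ∣ + k → ∃ λ T → IsMaximalClique G T × S ⊆ T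
      grow′ zero    n≤∣S∣+0 =
        ⊥-elim (<⇒≱ (<-≤-trans grows (∣p∣≤n (S ∪ ⁅ u ⁆))) (subst (n ≤_) (+-identityʳ _) n≤∣S∣+0))
      grow′ (suc k) n≤∣S∣+1+k with grow k (clique-∪-⁅⁆ S-clique u~S) (≤-trans n≤∣S∣+1+k ∣S∣+1+k≤)
        where
        ∣S∣+1+k≤ : ∣ S ∣ + suc k ≤ ∣ S ∪ ⁅ u ⁆ ∣ + k
        ∣S∣+1+k≤ = subst (_≤ ∣ S ∪ ⁅ u ⁆ ∣ + k) (sym (+-suc ∣ S ∣ k)) (+-monoˡ-≤ k grows)
      ... | T , T-max , S∪u⊆T = T , T-max , S∪u⊆T ∘ p⊆p∪q ⁅ u ⁆

  ⁅⁆-clique : ∀ x → IsClique G ⁅ x ⁆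
  ⁅⁆-clique x = (x , x∈⁅x⁆ x) , λ a b a∈ b∈ a≢b → ⊥-elim (a≢b (trans (x∈⁅y⁆⇒x≡y x a∈) (sym (x∈⁅y⁆⇒x≡y x b∈))))

  edge-in-maximal : adj G x y ≡ true → ∃ λ H → IsMaximalClique G H × x ∈ H × y ∈ H
  edge-in-maximal {x} {y} x~y with extend-to-maximal (clique-∪-⁅⁆ (⁅⁆-clique x) y~x)
    where
    y~x : Joinable ⁅ x ⁆ y
    y~x s s∈x _ rewrite x∈⁅y⁆⇒x≡y x s∈x = adj-sym x~y
  ... | H , H-max , x∪y⊆H = H , H-max , x∪y⊆H (p⊆p∪q ⁅ y ⁆ (x∈⁅x⁆ x)) , x∪y⊆H (q⊆p∪q ⁅ x ⁆ ⁅ y ⁆ (x∈⁅x⁆ y))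

  Γ-Chain : Subset n → Subset n → Set
  Γ-Chain = Chain (IsMaximalClique G) ΓAdj

  Γ-Chain-++ : ∀ {H₁ H₂ H₃} → Γ-Chain H₁ H₂ → Γ-Chain H₂ H₃ → Γ-Chain H₁ H₃
  Γ-Chain-++ (stop _)            c₂ = c₂
  Γ-Chain-++ (cons H-max adj c₁) c₂ = cons H-max adj (Γ-Chain-++ c₁ c₂)

  Γ-Chain-shared : IsMaximalClique G H → IsMaximalClique G H′ → x ∈ H → x ∈ H′ → Γ-Chain H H′
  Γ-Chain-shared {H} {H′} {x} H-max H′-max x∈H x∈H′ with ≡-dec Bool._≟_ H H′
  ... | yes refl = stop H-max
  ... | no  H≢H′ = cons H-max (H≢H′ , x , x∈p∩q⁺ (x∈H , x∈H′)) (stop H′-max)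

  Γ-Chain-walk : ∀ {k} → Walk G x y k → IsMaximalClique G H → x ∈ H → IsMaximalClique G H′ → y ∈ H′ →
                 Γ-Chain H H′
  Γ-Chain-walk here         H-max x∈H H′-max x∈H′ = Γ-Chain-shared H-max H′-max x∈H x∈H′
  Γ-Chain-walk (step x~z w) H-max x∈H H′-max y∈H′ with edge-in-maximal x~z
  ... | K , K-max , x∈K , z∈K = Γ-Chain-++ (Γ-Chain-shared H-max K-max x∈H x∈K) (Γ-Chain-walk w K-max z∈K H′-max y∈H′)

  Γ-connected : Connected G → ∀ H H′ → IsMaximalClique G H → IsMaximalClique G H′ → Γ-Chain H H′
  Γ-connected connected H H′ H-max@(((x , x∈H) , _) , _) H′-max@(((y , y∈H′) , _) , _) =
    Γ-Chain-walk (proj₂ (connected x y)) H-max x∈H H′-max y∈H′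

  Γ-nonempty : Fin n → ∃ (IsMaximalClique G)
  Γ-nonempty x with extend-to-maximal (⁅⁆-clique x)
  ... | H , H-max , _ = H , H-max

  ∉⇒≢ : u ∉ S → x ∈ S → x ≢ u
  ∉⇒≢ u∉S x∈S refl = u∉S x∈S

  within-clique : ∀ {K v} → IsMaximalClique G K → v ∉ K → x ∈ K → y ∈ K → Σ (Path x y) (Avoids v)
  within-clique {x} {y} K-max v∉K x∈K y∈K with x ≟ y
  ... | yes refl = [] , ∉⇒≢ v∉K x∈K
  ... | no  x≢y  = maximal-adj K-max x∈K y∈K x≢y ∷ [] , ∉⇒≢ v∉K x∈K , ∉⇒≢ v∉K y∈K

  along-chain : ∀ {v K K′ Ks} → Linked ΓAdj (K ∷ Ks List.++ [ K′ ]) → All (IsMaximalClique G) (K ∷ Ks) →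
                All (v ∉_) (K ∷ Ks) → y ∈ K → ∃ λ y′ → y′ ∈ K′ × Σ (Path y y′) (Avoids v)
  along-chain {K = K} {K′} {[]} ((_ , w , w∈K∩K′) ∷ [-]) (K-max ∷ []) (v∉K ∷ []) y∈K
    with x∈p∩q⁻ K K′ w∈K∩K′
  ... | w∈K , w∈K′ = w , w∈K′ , within-clique K-max v∉K y∈K w∈K
  along-chain {K = K} {K′} {K₂ ∷ Ks} ((_ , w , w∈K∩K₂) ∷ links) (K-max ∷ maxs) (v∉K ∷ v∉Ks) y∈K
    with x∈p∩q⁻ K K₂ w∈K∩K₂
  ... | w∈K , w∈K₂ with within-clique K-max v∉K y∈K w∈K | along-chain links maxs v∉Ks w∈K₂
  ...   | p , av-p | y′ , y′∈K′ , q , av-q = y′ , y′∈K′ , p ++ q , avoids-++ p q av-p av-q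
-- Consequences of QEC(G) < -1/2

module QEC-Inequalities {n : ℕ} (G : Graph n) (qec : QEC<-½ G) where
  open Paths G

  private variable
    o a b c p q r s p₁ p₂ p₃ p₄ : Fin n

  four-point : p₁ ≢ p₂ → p₁ ≢ p₃ → p₁ ≢ p₄ → p₂ ≢ p₃ → p₂ ≢ p₄ → p₃ ≢ p₄ →
               d⇄ p₁ p₃ + d⇄ p₂ p₄ + 2 < d⇄ p₁ p₂ + d⇄ p₂ p₃ + d⇄ p₃ p₄ + d⇄ p₄ p₁
  four-point {p₁} {p₂} {p₃} {p₄} p₁≢p₂ p₁≢p₃ p₁≢p₄ p₂≢p₃ p₂≢p₄ p₃≢p₄ =
    +m-+n<-+k⇒m+k<n _ _ 2 (subst (ℤ._< ℤ.- + 2) expansion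
      (qec-form G qec 1ℤ p₁ others unique (λ ()) refl (+ 2) refl))
    where
    others = (ℤ.- 1ℤ , p₂) ∷ (1ℤ , p₃) ∷ (ℤ.- 1ℤ , p₄) ∷ []
    unique = (p₁≢p₂ ∷ p₁≢p₃ ∷ p₁≢p₄ ∷ []) ∷ (p₂≢p₃ ∷ p₂≢p₄ ∷ []) ∷ (p₃≢p₄ ∷ []) ∷ [] ∷ []
    d : Fin n → Fin n → ℤ
    d x y = + dist G x y
    diagonal : d p₁ p₁ ℤ.+ d p₂ p₂ ℤ.+ d p₃ p₃ ℤ.+ d p₄ p₄ ≡ 0ℤ
    diagonal rewrite dist-refl p₁ | dist-refl p₂ | dist-refl p₃ | dist-refl p₄ = refl
    difference = + (d⇄ p₁ p₃ + d⇄ p₂ p₄) ℤ.- + (d⇄ p₁ p₂ + d⇄ p₂ p₃ + d⇄ p₃ p₄ + d⇄ p₄ p₁)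
    expansion : form ((1ℤ , p₁) ∷ others) d ≡ difference
    expansion = trans (cycle-expansion (d p₁ p₁) (d p₁ p₂) (d p₁ p₃) (d p₁ p₄) (d p₂ p₁) (d p₂ p₂)
                                       (d p₂ p₃) (d p₂ p₄) (d p₃ p₁) (d p₃ p₂) (d p₃ p₃) (d p₃ p₄)
                                       (d p₄ p₁) (d p₄ p₂) (d p₄ p₃) (d p₄ p₄))
                      (trans (cong (ℤ._+ difference) diagonal) (ℤP.+-identityˡ difference))

  claw-inequality : o ≢ a → o ≢ b → o ≢ c → a ≢ b → a ≢ c → b ≢ c →
                    d⇄ a b + d⇄ a c + d⇄ b c + 6 < 3 * (d⇄ o a + d⇄ o b + d⇄ o c)
  claw-inequality {o} {a} {b} {c} o≢a o≢b o≢c a≢b a≢c b≢c =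
    +m-+n<-+k⇒m+k<n _ _ 6 (subst (ℤ._< ℤ.- + 6) expansion
      (qec-form G qec (ℤ.- + 3) o leaves unique (λ ()) refl (+ 6) refl))
    where
    leaves = (1ℤ , a) ∷ (1ℤ , b) ∷ (1ℤ , c) ∷ []
    unique = (o≢a ∷ o≢b ∷ o≢c ∷ []) ∷ (a≢b ∷ a≢c ∷ []) ∷ (b≢c ∷ []) ∷ [] ∷ []
    d : Fin n → Fin n → ℤ
    d x y = + dist G x y
    diagonal : + 9 ℤ.* d o o ℤ.+ d a a ℤ.+ d b b ℤ.+ d c c ≡ 0ℤ
    diagonal rewrite dist-refl o | dist-refl a | dist-refl b | dist-refl c = refl
    expansion : form ((ℤ.- + 3 , o) ∷ leaves) d
                ≡ + (d⇄ a b + d⇄ a c + d⇄ b c) ℤ.- + (3 * (d⇄ o a + d⇄ o b + d⇄ o c))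
    expansion = trans (claw-expansion (d o o) (d o a) (d o b) (d o c) (d a o) (d a a) (d a b) (d a c)
                                      (d b o) (d b a) (d b b) (d b c) (d c o) (d c a) (d c b) (d c c))
                      (trans (cong₂ (λ D N → D ℤ.+ (+ (d⇄ a b + d⇄ a c + d⇄ b c) ℤ.- N))
                                    diagonal (sym (ℤP.pos-* 3 (d⇄ o a + d⇄ o b + d⇄ o c))))
                             (ℤP.+-identityˡ _))

  no-4-cycle-missing-chord : adj G p q ≡ true → adj G q r ≡ true → adj G r s ≡ true → adj G s p ≡ true →
                             p ≢ r → q ≢ s → adj G p r ≡ false → ⊥
  no-4-cycle-missing-chord {p} {q} {r} {s} p~q q~r r~s s~p p≢r q≢s p≁r = <-irrefl refl (begin-strict
    8                                                 ≤⟨ +-monoˡ-≤ 2 (+-mono-≤ (d⇄-nonadj (p~q ∷ q~r ∷ []) p≢r p≁r)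
                                                                              (d⇄-≢ (q~r ∷ r~s ∷ []) q≢s)) ⟩
    d⇄ p r + d⇄ q s + 2                               <⟨ four-point (adj⇒≢ p~q) p≢r (≢-sym (adj⇒≢ s~p))
                                                                    (adj⇒≢ q~r) q≢s (adj⇒≢ r~s) ⟩
    d⇄ p q + d⇄ q r + d⇄ r s + d⇄ s p                 ≤⟨ +-mono-≤ (+-mono-≤ (+-mono-≤ (d⇄-adj p~q) (d⇄-adj q~r))
                                                                             (d⇄-adj r~s)) (d⇄-adj s~p) ⟩
    8                                                 ∎)
    where open ≤-Reasoning

  no-induced-claw : adj G o a ≡ true → adj G o b ≡ true → adj G o c ≡ true → a ≢ b → a ≢ c → b ≢ c →
                    adj G a b ≡ false → adj G a c ≡ false → adj G b c ≡ false → ⊥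
  no-induced-claw {o} {a} {b} {c} o~a o~b o~c a≢b a≢c b≢c a≁b a≁c b≁c = <-irrefl refl (begin-strict
    18                             ≤⟨ +-monoˡ-≤ 6 (+-mono-≤ (+-mono-≤ (d⇄-nonadj a~o~b a≢b a≁b)
                                                                (d⇄-nonadj a~o~c a≢c a≁c))
                                                      (d⇄-nonadj b~o~c b≢c b≁c)) ⟩
    d⇄ a b + d⇄ a c + d⇄ b c + 6   <⟨ claw-inequality (adj⇒≢ o~a) (adj⇒≢ o~b) (adj⇒≢ o~c) a≢b a≢c b≢c ⟩
    3 * (d⇄ o a + d⇄ o b + d⇄ o c) ≤⟨ *-monoʳ-≤ 3 (+-mono-≤ (+-mono-≤ (d⇄-adj o~a) (d⇄-adj o~b)) (d⇄-adj o~c)) ⟩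
    18                             ∎)
    where
    open ≤-Reasoning
    a~o~b = adj-sym o~a ∷ o~b ∷ []
    a~o~c = adj-sym o~a ∷ o~c ∷ []
    b~o~c = adj-sym o~b ∷ o~c ∷ []

-- Maximal cliques under QEC(G) < -1/2

module MaximalCliques {n : ℕ} (G : Graph n) (qec : QEC<-½ G) where
  open Paths G
  open Cliques G
  open QEC-Inequalities G qec

  private variable
    a b u v w x y : Fin n

  shared-vertex-unique : ∀ {H H′} → IsMaximalClique G H → IsMaximalClique G H′ → H ≢ H′ →
                         u ∈ H → u ∈ H′ → w ∈ H → w ∈ H′ → u ≡ w
  shared-vertex-unique {u = u} {w = w} {H = H} {H′ = H′} H-max H′-max H≢H′ u∈H u∈H′ w∈H w∈H′ with u ≟ w
  ... | yes u≡w = u≡w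
  ... | no  u≢w with maximal-⊈ H-max (proj₁ H′-max) H≢H′
  ...   | a , a∈H , a∉H′ with outside-maximal H′-max a∉H′
  ...     | b , b∈H′ , b≢a , a≁b = ⊥-elim (no-4-cycle-missing-chord a~u u~b b~w w~a (≢-sym b≢a) u≢w a≁b)
    where
    a~u = maximal-adj H-max a∈H u∈H (≢-sym (∉⇒≢ a∉H′ u∈H′))
    w~a = maximal-adj H-max w∈H a∈H (∉⇒≢ a∉H′ w∈H′)
    u~b = maximal-adj H′-max u∈H′ b∈H′ (neighbour≢non-neighbour a~u a≁b)
    b~w = maximal-adj H′-max b∈H′ w∈H′ (≢-sym (neighbour≢non-neighbour (adj-sym w~a) a≁b))

  module SharedVertex {H H′ : Subset n} (H-max : IsMaximalClique G H) (H′-max : IsMaximalClique G H′)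
                      (H≢H′ : H ≢ H′) {v : Fin n} (v∈H : v ∈ H) (v∈H′ : v ∈ H′) where

    across-≢ : a ∈ H → a ≢ v → b ∈ H′ → a ≢ b
    across-≢ a∈H a≢v b∈H′ refl = a≢v (shared-vertex-unique H-max H′-max H≢H′ a∈H b∈H′ v∈H v∈H′)

    across-nonadjacent : a ∈ H → a ≢ v → b ∈ H′ → b ≢ v → adj G a b ≡ false
    across-nonadjacent {a} {b} a∈H a≢v b∈H′ b≢v with adj G a b in a~b
    ... | false = refl
    ... | true with b ∈? H
    ...   | yes b∈H = ⊥-elim (b≢v (shared-vertex-unique H-max H′-max H≢H′ b∈H b∈H′ v∈H v∈H′))
    ...   | no  b∉H with outside-maximal H-max b∉H
    ...     | e , e∈H , e≢b , b≁e = ⊥-elim (no-4-cycle-missing-chord e~a a~b b~v v~e e≢b a≢v e≁b)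
      where
      b~v = maximal-adj H′-max b∈H′ v∈H′ b≢v
      e~a = maximal-adj H-max e∈H a∈H (≢-sym (neighbour≢non-neighbour (adj-sym a~b) b≁e))
      v~e = maximal-adj H-max v∈H e∈H (neighbour≢non-neighbour b~v b≁e)
      e≁b = trans (Graph.sym G e b) b≁e

    neighbour-of-shared : adj G u v ≡ true → u ∈ H ⊎ u ∈ H′
    neighbour-of-shared {u} u~v with u ∈? H | u ∈? H′
    ... | yes u∈H | _        = inj₁ u∈H
    ... | no  _   | yes u∈H′ = inj₂ u∈H′
    ... | no  u∉H | no  u∉H′ with outside-maximal H-max u∉H | outside-maximal H′-max u∉H′
    ...   | h , h∈H , h≢u , u≁h | h′ , h′∈H′ , h′≢u , u≁h′ =
      ⊥-elim (no-induced-claw (adj-sym u~v) (maximal-adj H-max v∈H h∈H (≢-sym h≢v))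
                (maximal-adj H′-max v∈H′ h′∈H′ (≢-sym h′≢v)) (≢-sym h≢u) (≢-sym h′≢u)
                (across-≢ h∈H h≢v h′∈H′) u≁h u≁h′ (across-nonadjacent h∈H h≢v h′∈H′ h′≢v))
      where
      h≢v = ≢-sym (neighbour≢non-neighbour u~v u≁h)
      h′≢v = ≢-sym (neighbour≢non-neighbour u~v u≁h′)

    CrossingsAtLeast : ℕ → Set
    CrossingsAtLeast L = ∀ {a b} → a ∈ H → b ∈ H′ → (p : Path a b) → Avoids v p → L ≤ length p

    -- A crossing (a path from H to H′ avoiding v) of minimal length L, cut into P M Q, closes up
    -- through v to a cycle of length L + 2 that is isometric in G: a path between the ends of M is
    -- at least as long as the shorter of the two arcs of the cycle between them.
    module MinimalCrossing {L a b z₁ z₂} (crossings : CrossingsAtLeast L) (a∈H : a ∈ H) (b∈H′ : b ∈ H′)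
                           (P : Path a z₁) (M : Path z₁ z₂) (Q : Path z₂ b)
                           (av-P : Avoids v P) (av-M : Avoids v M) (av-Q : Avoids v Q)
                           (total : length P + (length M + length Q) ≡ L) where
      open ≤-Reasoning

      avoiding-bound : (X : Path z₁ z₂) → Avoids v X → length M ≤ length X
      avoiding-bound X av-X = +-cancelʳ-≤ (length Q) _ _ (+-cancelˡ-≤ (length P) _ _ (begin
        length P + (length M + length Q) ≡⟨ total ⟩
        L                                ≤⟨ crossings a∈H b∈H′ (P ++ X ++ Q)
                                              (avoids-++ P _ av-P (avoids-++ X Q av-X av-Q)) ⟩
        length (P ++ X ++ Q)             ≡⟨ length-++₃ P X Q ⟩
        length P + (length X + length Q) ∎))

      detour-bound : ∀ {ℓ} → Detour v z₁ z₂ ℓ → length M ≤ ℓ ⊎ length P + length Q + 2 ≤ ℓ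
      detour-bound {ℓ} (detour X₁ X₂ av₁ av₂ u~v v~u′ shorter) with neighbour-of-shared u~v
      ... | inj₂ u∈H′ = inj₁ (m+n≤o⇒m≤o (length M) (+-cancelˡ-≤ (length P) _ _ (begin
        length P + (length M + length Q) ≡⟨ total ⟩
        L                                ≤⟨ crossings a∈H u∈H′ (P ++ X₁) (avoids-++ P X₁ av-P av₁) ⟩
        length (P ++ X₁)                 ≡⟨ length-++ P X₁ ⟩
        length P + length X₁             ≤⟨ +-monoʳ-≤ (length P) (≤-trans (m≤m+n _ (length X₂ + 2)) X₁+X₂+2≤ℓ) ⟩
        length P + ℓ                     ∎)))
        where X₁+X₂+2≤ℓ = subst (_≤ ℓ) (+-assoc (length X₁) _ 2) shorter
      ... | inj₁ u∈H with neighbour-of-shared (adj-sym v~u′)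
      ...   | inj₁ u′∈H = inj₁ (m+n≤o⇒n≤o (length P) (+-cancelʳ-≤ (length Q) _ _ (begin
        length P + length M + length Q   ≡⟨ +-assoc (length P) _ _ ⟩
        length P + (length M + length Q) ≡⟨ total ⟩
        L                                ≤⟨ crossings u′∈H b∈H′ (X₂ ++ Q) (avoids-++ X₂ Q av₂ av-Q) ⟩
        length (X₂ ++ Q)                 ≡⟨ length-++ X₂ Q ⟩
        length X₂ + length Q             ≤⟨ +-monoˡ-≤ (length Q) (≤-trans (m≤n+m _ (length X₁))
                                                                          (≤-trans (m≤m+n _ 2) shorter)) ⟩
        ℓ + length Q                     ∎)))
      ...   | inj₂ u′∈H′ = inj₂ (≤-trans (+-monoˡ-≤ 2 (+-mono-≤ P≤X₁ Q≤X₂)) shorter)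
        where
        P≤X₁ : length P ≤ length X₁
        P≤X₁ = +-cancelʳ-≤ (length M + length Q) _ _ (begin
          length P + (length M + length Q)  ≡⟨ total ⟩
          L                                 ≤⟨ crossings u∈H b∈H′ (reverse X₁ ++ M ++ Q)
                                                 (avoids-++ (reverse X₁) _ (avoids-reverse X₁ av₁)
                                                                              (avoids-++ M Q av-M av-Q)) ⟩
          length (reverse X₁ ++ M ++ Q)     ≡⟨ length-++₃ (reverse X₁) M Q ⟩
          length (reverse X₁) + (length M + length Q) ≡⟨ cong (_+ _) (length-reverse X₁) ⟩
          length X₁ + (length M + length Q) ∎)
        Q≤X₂ : length Q ≤ length X₂
        Q≤X₂ = +-cancelˡ-≤ (length M) _ _ (+-cancelˡ-≤ (length P) _ _ (begin
          length P + (length M + length Q)  ≡⟨ total ⟩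
          L                                 ≤⟨ crossings a∈H u′∈H′ (P ++ M ++ reverse X₂)
                                                 (avoids-++ P _ av-P (avoids-++ M _ av-M (avoids-reverse X₂ av₂))) ⟩
          length (P ++ M ++ reverse X₂)     ≡⟨ length-++₃ P M (reverse X₂) ⟩
          length P + (length M + length (reverse X₂)) ≡⟨ cong (λ ℓ → length P + (length M + ℓ)) (length-reverse X₂) ⟩
          length P + (length M + length X₂) ∎))

      isometric : ∀ t → t ≤ length M → t ≤ length P + length Q + 2 → (X : Path z₁ z₂) → t ≤ length X
      isometric t t≤M t≤P+Q+2 X with avoids-or-detour X (avoids-head M av-M) (avoids-last M av-M)
      ... | inj₁ av-X = ≤-trans t≤M (avoiding-bound X av-X)
      ... | inj₂ d with detour-bound d
      ...   | inj₁ M≤X     = ≤-trans t≤M M≤X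
      ...   | inj₂ P+Q+2≤X = ≤-trans t≤P+Q+2 P+Q+2≤X

    -- On a shortest crossing p of length k + 1 + j with |k - j| ≤ 1, the vertices a, z₂ = p[k],
    -- z₃ = p[k + 1], b split the isometric cycle p·v into arcs k, 1, j, 2, and the four-point
    -- inequality fails for them.
    module ShortestCrossing {a b} (a∈H : a ∈ H) (b∈H′ : b ∈ H′) (p : Path a b) (av : Avoids v p)
                            (crossings : CrossingsAtLeast (length p)) where

      private
        a≢v = avoids-head p av
        b≢v = avoids-last p av

        segment-lengths : ∀ i r → i + r ≡ length p → length (take p i) ≡ i × length (drop p i) ≡ r
        segment-lengths i r i+r≡l = length-take p (subst (i ≤_) i+r≡l (m≤m+n i r)) ,
                                    trans (length-drop p i) (trans (cong (_∸ i) (sym i+r≡l)) (m+n∸m≡n i r))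

      to-vertex : ∀ i r t → i + r ≡ length p → t ≤ i → t ≤ r + 2 → (X : Path a (vertexAt p i)) → t ≤ length X
      to-vertex i r t i+r≡l t≤i t≤r+2 with segment-lengths i r i+r≡l
      ... | ℓ₁ , ℓ₂ = MinimalCrossing.isometric crossings a∈H b∈H′ [] (take p i) (drop p i)
                        a≢v (avoids-take p i av) (avoids-drop p i av) (trans (cong₂ _+_ ℓ₁ ℓ₂) i+r≡l)
                        t (subst (t ≤_) (sym ℓ₁) t≤i) (subst (λ ℓ → t ≤ ℓ + 2) (sym ℓ₂) t≤r+2)

      from-vertex : ∀ i r t → i + r ≡ length p → t ≤ r → t ≤ i + 2 → (X : Path (vertexAt p i) b) → t ≤ length X
      from-vertex i r t i+r≡l t≤r t≤i+2 with segment-lengths i r i+r≡l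
      ... | ℓ₁ , ℓ₂ = MinimalCrossing.isometric crossings a∈H b∈H′ (take p i) (drop p i) []
                        (avoids-take p i av) (avoids-drop p i av) b≢v
                        (trans (cong₂ _+_ ℓ₁ (trans (+-identityʳ _) ℓ₂)) i+r≡l)
                        t (subst (t ≤_) (sym ℓ₂) t≤r) (subst (λ ℓ → t ≤ ℓ + 2) (sym (trans (+-identityʳ _) ℓ₁)) t≤i+2)

      not-long : ∀ {k j} → length p ≡ suc (k + j) → 1 ≤ k → k ≤ j → j ≤ suc k → ⊥
      not-long {k} {j} len 1≤k k≤j j≤1+k = <-irrefl refl (begin-strict
        suc k + suc k + (suc j + suc j) + 2     ≤⟨ +-monoˡ-≤ 2 (+-mono-≤ (d⇄-≥ (take p (suc k)) (suc k) a⇝z₃)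
                                                                       (d⇄-≥ (drop p k) (suc j) z₂⇝b)) ⟩
        d⇄ a z₃ + d⇄ z₂ b + 2                   <⟨ four-point a≢z₂ a≢z₃ (across-≢ a∈H a≢v b∈H′)
                                                              (adj⇒≢ z₂~z₃) z₂≢b z₃≢b ⟩
        d⇄ a z₂ + d⇄ z₂ z₃ + d⇄ z₃ b + d⇄ b a   ≤⟨ +-mono-≤ (+-mono-≤ (+-mono-≤ a⇝z₂ (d⇄-adj z₂~z₃)) z₃⇝b) b⇝a ⟩
        k + k + 2 + (j + j) + (2 + 2)           ≡⟨ balance k j ⟨
        suc k + suc k + (suc j + suc j) + 2     ∎)
        where
        open ≤-Reasoning
        balance : ∀ k j → suc k + suc k + (suc j + suc j) + 2 ≡ k + k + 2 + (j + j) + (2 + 2)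
        balance = ℕ-Solver.solve-∀
        z₂ = vertexAt p k
        z₃ = vertexAt p (suc k)
        z₂~z₃ = vertexAt-step p (subst (k <_) (sym len) (s≤s (m≤m+n k j)))
        1+k+j≡l = sym len
        k+1+j≡l = trans (+-suc k j) (sym len)
        a⇝z₃ = to-vertex (suc k) j (suc k) 1+k+j≡l ≤-refl
                 (subst (suc k ≤_) (+-comm 2 j) (s≤s (≤-trans k≤j (n≤1+n j))))
        z₂⇝b = from-vertex k (suc j) (suc j) k+1+j≡l ≤-refl (subst (suc j ≤_) (+-comm 2 k) (s≤s j≤1+k))
        a≢z₂ = positive-length⇒≢ (to-vertex k (suc j) 1 k+1+j≡l 1≤k (s≤s z≤n))
        a≢z₃ = positive-length⇒≢ (≤-trans (s≤s z≤n) ∘ a⇝z₃)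
        z₂≢b = positive-length⇒≢ (≤-trans (s≤s z≤n) ∘ z₂⇝b)
        z₃≢b = positive-length⇒≢ (from-vertex (suc k) j 1 1+k+j≡l (≤-trans 1≤k k≤j) (s≤s z≤n))
        a⇝z₂ : d⇄ a z₂ ≤ k + k
        a⇝z₂ = subst (λ ℓ → d⇄ a z₂ ≤ ℓ + ℓ) (proj₁ (segment-lengths k (suc j) k+1+j≡l)) (d⇄-≤ (take p k))
        z₃⇝b : d⇄ z₃ b ≤ j + j
        z₃⇝b = subst (λ ℓ → d⇄ z₃ b ≤ ℓ + ℓ) (proj₂ (segment-lengths (suc k) j 1+k+j≡l)) (d⇄-≤ (drop p (suc k)))
        b⇝a : d⇄ b a ≤ 2 + 2
        b⇝a = d⇄-≤ (maximal-adj H′-max b∈H′ v∈H′ b≢v ∷ maximal-adj H-max v∈H a∈H (≢-sym a≢v) ∷ [])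

    NoCrossing : ℕ → Set
    NoCrossing L = ∀ {a b} → a ∈ H → b ∈ H′ → (p : Path a b) → Avoids v p → length p ≡ L → ⊥

    no-shortest-crossing : ∀ {L} → CrossingsAtLeast L → NoCrossing L
    no-shortest-crossing _ a∈H a∈H′ [] a≢v _ = a≢v (shared-vertex-unique H-max H′-max H≢H′ a∈H a∈H′ v∈H v∈H′)
    no-shortest-crossing _ a∈H b∈H′ (a~b ∷ []) (a≢v , b≢v) _ =
      neighbour≢non-neighbour a~b (across-nonadjacent a∈H a≢v b∈H′ b≢v) refl
    no-shortest-crossing _ a∈H b∈H′ (a~w ∷ w~b ∷ []) (a≢v , w≢v , b≢v) _ =
      no-4-cycle-missing-chord a~w w~b (maximal-adj H′-max b∈H′ v∈H′ b≢v) (maximal-adj H-max v∈H a∈H (≢-sym a≢v))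
        (across-≢ a∈H a≢v b∈H′) w≢v (across-nonadjacent a∈H a≢v b∈H′ b≢v)
    no-shortest-crossing crossings a∈H b∈H′ p@(_ ∷ _ ∷ _ ∷ q) av refl =
      ShortestCrossing.not-long a∈H b∈H′ p av crossings
        (cong suc (sym (⌊n/2⌋+⌈n/2⌉≡n m))) (s≤s z≤n) (⌊n/2⌋≤⌈n/2⌉ m) (⌈n/2⌉≤1+⌊n/2⌋ m)
      where m = suc (suc (length q))

    no-crossing : a ∈ H → b ∈ H′ → (p : Path a b) → Avoids v p → ⊥
    no-crossing a∈H b∈H′ p av = <-rec NoCrossing induction-step (length p) a∈H b∈H′ p av refl
      where
      induction-step : ∀ L → (∀ {L′} → L′ < L → NoCrossing L′) → NoCrossing L
      induction-step L shorter-impossible = no-shortest-crossing crossings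
        where
        crossings : CrossingsAtLeast L
        crossings a∈H b∈H′ q av-q with L ≤? length q
        ... | yes L≤q = L≤q
        ... | no  L≰q = ⊥-elim (shorter-impossible (≰⇒> L≰q) a∈H b∈H′ q av-q refl)

  other-vertex : Nonisolated → ∀ {H} → IsMaximalClique G H → v ∈ H → ∃ λ a → a ∈ H × a ≢ v
  other-vertex {v} nonisolated-G {H} H-max v∈H with nonisolated-G v
  ... | z , v~z with z ∈? H
  ...   | yes z∈H = z , z∈H , ≢-sym (adj⇒≢ v~z)
  ...   | no  z∉H with outside-maximal H-max z∉H
  ...     | h , h∈H , _ , z≁h = h , h∈H , ≢-sym (neighbour≢non-neighbour (adj-sym v~z) z≁h)

  no-three-share : Nonisolated → ∀ {H₁ H₂ H₃} →
                   IsMaximalClique G H₁ → IsMaximalClique G H₂ → IsMaximalClique G H₃ →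
                   H₁ ≢ H₂ → H₂ ≢ H₃ → H₁ ≢ H₃ → v ∈ H₁ → v ∈ H₂ → v ∈ H₃ → ⊥
  no-three-share nonisolated-G m₁ m₂ m₃ H₁≢H₂ H₂≢H₃ H₁≢H₃ v∈H₁ v∈H₂ v∈H₃
    with other-vertex nonisolated-G m₁ v∈H₁ | other-vertex nonisolated-G m₂ v∈H₂ | other-vertex nonisolated-G m₃ v∈H₃
  ... | a₁ , a₁∈H₁ , a₁≢v | a₂ , a₂∈H₂ , a₂≢v | a₃ , a₃∈H₃ , a₃≢v =
    no-induced-claw (maximal-adj m₁ v∈H₁ a₁∈H₁ (≢-sym a₁≢v)) (maximal-adj m₂ v∈H₂ a₂∈H₂ (≢-sym a₂≢v))
                    (maximal-adj m₃ v∈H₃ a₃∈H₃ (≢-sym a₃≢v))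
                    (S₁₂.across-≢ a₁∈H₁ a₁≢v a₂∈H₂) (S₁₃.across-≢ a₁∈H₁ a₁≢v a₃∈H₃) (S₂₃.across-≢ a₂∈H₂ a₂≢v a₃∈H₃)
                    (S₁₂.across-nonadjacent a₁∈H₁ a₁≢v a₂∈H₂ a₂≢v) (S₁₃.across-nonadjacent a₁∈H₁ a₁≢v a₃∈H₃ a₃≢v)
                    (S₂₃.across-nonadjacent a₂∈H₂ a₂≢v a₃∈H₃ a₃≢v)
    where
    module S₁₂ = SharedVertex m₁ m₂ H₁≢H₂ v∈H₁ v∈H₂
    module S₁₃ = SharedVertex m₁ m₃ H₁≢H₃ v∈H₁ v∈H₃
    module S₂₃ = SharedVertex m₂ m₃ H₂≢H₃ v∈H₂ v∈H₃

  ∩-singleton : ∀ H₁ H₂ → IsMaximalClique G H₁ → IsMaximalClique G H₂ → ΓAdj H₁ H₂ → ∣ H₁ ∩ H₂ ∣ ≡ 1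
  ∩-singleton H₁ H₂ m₁ m₂ (H₁≢H₂ , x , x∈H₁∩H₂) = trans (cong ∣_∣ (⊆-antisym ⊆⁅x⁆ ⁅x⁆⊆)) (∣⁅x⁆∣≡1 x)
    where
    ⊆⁅x⁆ : H₁ ∩ H₂ ⊆ ⁅ x ⁆
    ⊆⁅x⁆ {y} y∈H₁∩H₂ with x∈p∩q⁻ H₁ H₂ y∈H₁∩H₂ | x∈p∩q⁻ H₁ H₂ x∈H₁∩H₂
    ... | y∈H₁ , y∈H₂ | x∈H₁ , x∈H₂ rewrite shared-vertex-unique m₁ m₂ H₁≢H₂ y∈H₁ y∈H₂ x∈H₁ x∈H₂ = x∈⁅x⁆ x
    ⁅x⁆⊆ : ⁅ x ⁆ ⊆ H₁ ∩ H₂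
    ⁅x⁆⊆ y∈⁅x⁆ rewrite x∈⁅y⁆⇒x≡y x y∈⁅x⁆ = x∈H₁∩H₂

  ∩∩-empty : Nonisolated → ∀ H₁ H₂ H₃ → IsMaximalClique G H₁ → IsMaximalClique G H₂ → IsMaximalClique G H₃ →
             H₁ ≢ H₂ → H₂ ≢ H₃ → H₁ ≢ H₃ → Empty (H₁ ∩ H₂ ∩ H₃)
  ∩∩-empty nonisolated-G H₁ H₂ H₃ m₁ m₂ m₃ H₁≢H₂ H₂≢H₃ H₁≢H₃ (x , x∈H₁∩H₂∩H₃) with x∈p∩q⁻ H₁ (H₂ ∩ H₃) x∈H₁∩H₂∩H₃
  ... | x∈H₁ , x∈H₂∩H₃ with x∈p∩q⁻ H₂ H₃ x∈H₂∩H₃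
  ...   | x∈H₂ , x∈H₃ = no-three-share nonisolated-G m₁ m₂ m₃ H₁≢H₂ H₂≢H₃ H₁≢H₃ x∈H₁ x∈H₂ x∈H₃

  -- Around a Γ-cycle H₀ H₁ H₂ … H₀ with v ∈ H₀ ∩ H₁, the cliques H₂ … miss v, so they carry a
  -- crossing from H₁ to H₀ around v.
  Γ-acyclic : Nonisolated → ∀ H₀ Hs → ¬ IsCycle (IsMaximalClique G) ΓAdj H₀ Hs
  Γ-acyclic _ H₀ []       (() , _)
  Γ-acyclic _ H₀ (_ ∷ []) (s≤s () , _)
  Γ-acyclic nonisolated-G H₀ (H₁ ∷ H₂ ∷ Hs)
    (_ , ((H₀≢H₁ ∷ H₀≢Hs) ∷ H₁≢Hs ∷ _) , (m₀ ∷ m₁ ∷ maxs) , ((_ , v , v∈H₀∩H₁) ∷ (_ , y , y∈H₁∩H₂) ∷ links))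
    with x∈p∩q⁻ H₀ H₁ v∈H₀∩H₁ | x∈p∩q⁻ H₁ H₂ y∈H₁∩H₂
  ... | v∈H₀ , v∈H₁ | y∈H₁ , y∈H₂ with along-chain links maxs (v∉ maxs H₀≢Hs H₁≢Hs) y∈H₂
    where
    v∉ : ∀ {Ks} → All (IsMaximalClique G) Ks → All (H₀ ≢_) Ks → All (H₁ ≢_) Ks → All (v ∉_) Ks
    v∉ []       []             []             = []
    v∉ (m ∷ ms) (H₀≢K ∷ H₀≢Ks) (H₁≢K ∷ H₁≢Ks) =
      (λ v∈K → no-three-share nonisolated-G m₀ m₁ m H₀≢H₁ H₁≢K H₀≢K v∈H₀ v∈H₁ v∈K) ∷ v∉ ms H₀≢Ks H₁≢Ks
  ... | y′ , y′∈H₀ , p , av-p = SharedVertex.no-crossing m₁ m₀ (≢-sym H₀≢H₁) v∈H₁ v∈H₀ y∈H₁ y′∈H₀ p av-p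
theorem4p5 : (n : ℕ) → 2 ≤ n → (G : Graph n) → Connected G → QEC<-½ G →
    CliqueGraphIsTree G ×
    (∀ H₁ H₂ → IsMaximalClique G H₁ → IsMaximalClique G H₂ → ΓAdj H₁ H₂ →
      ∣ H₁ ∩ H₂ ∣ ≡ 1) ×
    (∀ H₁ H₂ H₃ → IsMaximalClique G H₁ → IsMaximalClique G H₂ →
      IsMaximalClique G H₃ → H₁ ≢ H₂ → H₂ ≢ H₃ → H₁ ≢ H₃ →
      Empty (H₁ ∩ H₂ ∩ H₃))
theorem4p5 n 2≤n G connected qec =
  (Γ-nonempty (Fin.fromℕ< 2≤n) , Γ-connected connected , Γ-acyclic nonisolated-G) ,
  ∩-singleton ,
  ∩∩-empty nonisolated-G
  where
  open Paths G using (nonisolated)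
  open Cliques G
  open MaximalCliques G qec
  nonisolated-G = nonisolated 2≤n connected
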